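{- Let $A$ be an interface and $U\subseteq\mathcal{M}_f(|A|)$. Then: (i) for $a\in|A|$, $[a]\in P_{!A}(U)$ iff there is $x\subseteq|A|$ with $[b]\in U$ for all $b\in x$ and $a\in P_A(x)$; (ii) for $l,l'\in\mathcal{M}_f(|A|)$, $l+l'\in P_{!A}(U)$ iff there are $V,V'\subseteq\mathcal{M}_f(|A|)$ with $V\star V'\subseteq U$, $l\in P_{!A}(V)$ and $l'\in P_{!A}(V')$; (iii) $[a]\in P_{?A}(U)$ iff for every $x\subseteq|A|$ such that $[b]\in\overline{U}$ for all $b\in\overline{x}$, we have $a\in P_A(x)$; (iv) $l+l'\in P_{?A}(U)$ iff for all $V,V'\subseteq\mathcal{M}_f(|A|)$ with $\overline{V}\star\overline{V'}\subseteq\overline{U}$, $l\in P_{?A}(V)$ or $l'\in P_{?A}(V')$.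
   Context: A monotonic predicate transformer on a set $S$ is a monotone map $P:\mathcal{P}(S)\to\mathcal{P}(S)$. An interface $X$ is a pair $(|X|,P_X)$ of a set and a monotonic predicate transformer on it. Complements $\overline{x}$ are taken in the relevant ambient set ($|A|$ or $\mathcal{M}_f(|A|)$). $X^\bot=(|X|,P_X^\bot)$ with $P_X^\bot(x)=\overline{P_X(\overline{x})}$. $\mathcal{M}_f(S)$ is the set of finite multisets over $S$, written $[s_1,\dots,s_n]$; $+$ is multiset union; for $V,V'\subseteq\mathcal{M}_f(S)$, $V\star V'=\{u+v\mid u\in V,v\in V'\}$; for $x_1,\dots,x_n\subseteq S$, $\prod_i x_i=\{[b_1,\dots,b_n]\mid b_i\in x_i\}$. $!X=(\mathcal{M}_f(|X|),P_{!X})$ where $[a_1,\dots,a_n]\in P_{!X}(U)$ iff there exist $x_1,\dots,x_n\subseteq|X|$ with $\prod_i x_i\subseteq U$ and $a_i\in P_X(x_i)$ for all $i$; $?X=(!(X^\bot))^\bot$. -}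

module Defs where

open import Level using (0ℓ) renaming (suc to lsuc)
import Data.List
open import Data.List using (List; []; _∷_; _++_)
open import Data.Unit using (⊤)
open import Data.Empty using (⊥)
open import Data.List.Relation.Binary.Permutation.Propositional using (_↭_)
open import Data.Product using (Σ; ∃; ∃₂; _×_)
open import Relation.Unary using (Pred; _⊆_; _∈_; ∁)

record Interface : Set₁ where
  field
    Carrier : Set
    P       : Pred Carrier 0ℓ → Pred Carrier 0ℓ
    mono    : ∀ {x y : Pred Carrier 0ℓ} → x ⊆ y → P x ⊆ P y

dualPT : {S : Set} → (Pred S 0ℓ → Pred S 0ℓ) → Pred S 0ℓ → Pred S 0ℓ
dualPT P x = ∁ (P (∁ x))

-- Finite multisets over S are represented by lists, considered up to
-- permutation (_↭_).  A subset of M_f(S) is a predicate on lists that is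
-- invariant under permutation.
Invariant : {S : Set} {ℓ : _} → Pred (List S) ℓ → Set ℓ
Invariant U = ∀ {l l'} → l ↭ l' → U l → U l'

Fits : {S : Set} → List S → List (Pred S 0ℓ) → Set
Fits []       []       = ⊤
Fits (b ∷ bs) (x ∷ xs) = x b × Fits bs xs
Fits []       (_ ∷ _)  = ⊥
Fits (_ ∷ _)  []       = ⊥

Prod : {S : Set} → List (Pred S 0ℓ) → Pred (List S) 0ℓ
Prod xs w = ∃ λ bs → Fits bs xs × (w ↭ bs)

Star : {S : Set} → Pred (List S) 0ℓ → Pred (List S) 0ℓ → Pred (List S) 0ℓ
Star V V' w = ∃₂ λ u v → V u × V' v × (w ↭ (u ++ v))

BangPT : {S : Set} → (Pred S 0ℓ → Pred S 0ℓ) → Pred (List S) 0ℓ → Pred (List S) (lsuc 0ℓ)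
BangPT P U l = ∃ λ (xs : List (Pred _ 0ℓ)) → (Prod xs ⊆ U) × Fits l (Data.List.map P xs)

WhyPT : {S : Set} → (Pred S 0ℓ → Pred S 0ℓ) → Pred (List S) 0ℓ → Pred (List S) (lsuc 0ℓ)
WhyPT P U = ∁ (BangPT (dualPT P) (∁ U))

-- A witness x₁,…,xₙ for l ++ l' ∈ P_{!A}(U) splits into witnesses ys, zs for l and l',
-- and ∏(ys ++ zs) = ∏ys ⋆ ∏zs, so V := ∏ys, V' := ∏zs is the canonical choice in (ii);
-- (i) is the case of a single witness x.
-- Since ?A is defined as the dual of !(A⊥), parts (iii) and (iv) are the classical
-- negations of (i) and (ii) for the transformer P_A⊥ and the set ∁U, after
-- reindexing the quantified sets by complementation (x ↦ ∁x, V ↦ ∁V).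
module Submission where

open import Defs
open import Level using (0ℓ) renaming (suc to lsuc)
open import Axiom.ExcludedMiddle using (ExcludedMiddle)
open import Axiom.DoubleNegationElimination using (em⇒dne)
open import Data.List using (List; []; _∷_; [_]; _++_; map)
open import Data.List.Properties using (map-++)
open import Data.List.Relation.Binary.Permutation.Propositional using (↭-sym; ↭-trans; ↭-refl)
open import Data.List.Relation.Binary.Permutation.Propositional.Properties using (++⁺)
open import Data.Product using (∃; ∃₂; _×_; _,_)
open import Data.Sum using (_⊎_; inj₁; inj₂)
open import Data.Unit using (tt)
open import Function.Base using (id)
open import Function.Bundles using (_⇔_; mk⇔; Equivalence)
open import Relation.Binary.PropositionalEquality using (_≡_; refl; sym; subst)
open import Relation.Nullary using (¬_; Dec; yes; no)
open import Relation.Unary using (Pred; _⊆_; _∈_; ∁)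

¬×⇒¬⊎¬ : ∀ {a b} {A : Set a} {B : Set b} → Dec A → ¬ (A × B) → ¬ A ⊎ ¬ B
¬×⇒¬⊎¬ (yes a) ¬ab = inj₂ λ b → ¬ab (a , b)
¬×⇒¬⊎¬ (no ¬a) _   = inj₁ ¬a

module _ {S : Set} where

  Fits-++⁺ : {bs cs : List S} (ys : List (Pred S 0ℓ)) {zs : List (Pred S 0ℓ)} →
    Fits bs ys → Fits cs zs → Fits (bs ++ cs) (ys ++ zs)
  Fits-++⁺ {[]}    []       _        g = g
  Fits-++⁺ {_ ∷ _} (_ ∷ ys) (p , f)  g = p , Fits-++⁺ ys f g

  Fits-++⁻ : {bs : List S} (ys : List (Pred S 0ℓ)) {zs : List (Pred S 0ℓ)} →
    Fits bs (ys ++ zs) → ∃₂ λ bs₁ bs₂ → bs ≡ bs₁ ++ bs₂ × Fits bs₁ ys × Fits bs₂ zs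
  Fits-++⁻ {bs}    []       f = [] , bs , refl , tt , f
  Fits-++⁻ {b ∷ _} (_ ∷ ys) (p , f) with Fits-++⁻ ys f
  ... | bs₁ , bs₂ , refl , f₁ , f₂ = b ∷ bs₁ , bs₂ , refl , (p , f₁) , f₂

  Fits-map-++⁻ : ∀ {a} {T : Set a} (f : T → Pred S 0ℓ) (l : List S) {l' : List S} {xs : List T} →
    Fits (l ++ l') (map f xs) →
    ∃₂ λ xs₁ xs₂ → xs ≡ xs₁ ++ xs₂ × Fits l (map f xs₁) × Fits l' (map f xs₂)
  Fits-map-++⁻ f []      {xs = xs}    h = [] , xs , refl , tt , h
  Fits-map-++⁻ f (_ ∷ l) {xs = x ∷ _} (p , h) with Fits-map-++⁻ f l h
  ... | xs₁ , xs₂ , refl , h₁ , h₂ = x ∷ xs₁ , xs₂ , refl , (p , h₁) , h₂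

  ∁-invariant : {U : Pred (List S) 0ℓ} → Invariant U → Invariant (∁ U)
  ∁-invariant inv l↭l' ∉U ∈U = ∉U (inv (↭-sym l↭l') ∈U)

  Prod-invariant : (xs : List (Pred S 0ℓ)) → Invariant (Prod xs)
  Prod-invariant xs l↭l' (bs , f , l↭bs) = bs , f , ↭-trans (↭-sym l↭l') l↭bs

  Prod-[]⊆ : {U : Pred (List S) 0ℓ} → Invariant U → (x : Pred S 0ℓ) →
    (∀ b → b ∈ x → [ b ] ∈ U) → Prod [ x ] ⊆ U
  Prod-[]⊆ inv x h (b ∷ [] , (b∈x , _) , w↭) = inv (↭-sym w↭) (h b b∈x)

  Star-mono : {V V' W W' : Pred (List S) 0ℓ} → V ⊆ W → V' ⊆ W' → Star V V' ⊆ Star W W'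
  Star-mono V⊆W V'⊆W' (u , v , u∈V , v∈V' , w↭) = u , v , V⊆W u∈V , V'⊆W' v∈V' , w↭

  Star-Prod⊆Prod-++ : (ys zs : List (Pred S 0ℓ)) → Star (Prod ys) (Prod zs) ⊆ Prod (ys ++ zs)
  Star-Prod⊆Prod-++ ys zs (u , v , (bs , fb , u↭) , (cs , fc , v↭) , w↭) =
    bs ++ cs , Fits-++⁺ ys fb fc , ↭-trans w↭ (++⁺ u↭ v↭)

  Prod-++⊆Star-Prod : (ys zs : List (Pred S 0ℓ)) → Prod (ys ++ zs) ⊆ Star (Prod ys) (Prod zs)
  Prod-++⊆Star-Prod ys zs (bs , f , w↭) with Fits-++⁻ ys f
  ... | bs₁ , bs₂ , refl , f₁ , f₂ = bs₁ , bs₂ , (bs₁ , f₁ , ↭-refl) , (bs₂ , f₂ , ↭-refl) , w↭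

  module _ (P : Pred S 0ℓ → Pred S 0ℓ) where

    BangPT-mono : {U U' : Pred (List S) 0ℓ} → U ⊆ U' → {l : List S} → BangPT P U l → BangPT P U' l
    BangPT-mono U⊆U' (xs , ∏xs⊆U , f) = xs , (λ w → U⊆U' (∏xs⊆U w)) , f

    BangPT-[]⇔ : {U : Pred (List S) 0ℓ} → Invariant U → (a : S) →
      BangPT P U [ a ] ⇔ ∃ λ (x : Pred S 0ℓ) → (∀ b → b ∈ x → [ b ] ∈ U) × a ∈ P x
    BangPT-[]⇔ {U} inv a = mk⇔ to from
      where
      to : BangPT P U [ a ] → ∃ λ x → (∀ b → b ∈ x → [ b ] ∈ U) × a ∈ P x
      to (x ∷ [] , ∏x⊆U , (a∈Px , _)) = x , (λ b b∈x → ∏x⊆U ([ b ] , (b∈x , tt) , ↭-refl)) , a∈Px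
      from : (∃ λ x → (∀ b → b ∈ x → [ b ] ∈ U) × a ∈ P x) → BangPT P U [ a ]
      from (x , h , a∈Px) = [ x ] , Prod-[]⊆ inv x h , (a∈Px , tt)

    BangPT-++⇔ : (U : Pred (List S) 0ℓ) (l l' : List S) →
      BangPT P U (l ++ l') ⇔ ∃₂ λ (V V' : Pred (List S) 0ℓ) →
        Invariant V × Invariant V' × (Star V V' ⊆ U) × BangPT P V l × BangPT P V' l'
    BangPT-++⇔ U l l' = mk⇔ to from
      where
      to : BangPT P U (l ++ l') → ∃₂ λ V V' →
        Invariant V × Invariant V' × (Star V V' ⊆ U) × BangPT P V l × BangPT P V' l'
      to (xs , ∏xs⊆U , f) with Fits-map-++⁻ P l f
      ... | ys , zs , refl , f₁ , f₂ =
        Prod ys , Prod zs , Prod-invariant ys , Prod-invariant zs ,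
        (λ w → ∏xs⊆U (Star-Prod⊆Prod-++ ys zs w)) , (ys , id , f₁) , (zs , id , f₂)
      from : (∃₂ λ V V' →
        Invariant V × Invariant V' × (Star V V' ⊆ U) × BangPT P V l × BangPT P V' l') →
        BangPT P U (l ++ l')
      from (V , V' , _ , _ , V⋆V'⊆U , (ys , ∏ys⊆V , f₁) , (zs , ∏zs⊆V' , f₂)) =
        ys ++ zs ,
        (λ w → V⋆V'⊆U (Star-mono ∏ys⊆V ∏zs⊆V' (Prod-++⊆Star-Prod ys zs w))) ,
        subst (Fits (l ++ l')) (sym (map-++ P ys zs)) (Fits-++⁺ (map P ys) f₁ f₂)

module _ (em : ExcludedMiddle 0ℓ) (A : Interface) where
  open Interface A renaming (Carrier to S)

  private
    ∁∁⊆ : {T : Set} (x : Pred T 0ℓ) → ∁ (∁ x) ⊆ x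
    ∁∁⊆ x = em⇒dne em

  WhyPT-[]⇔ : {U : Pred (List S) 0ℓ} → Invariant U → (a : S) →
    WhyPT P U [ a ] ⇔ (∀ (x : Pred S 0ℓ) → (∀ b → b ∈ ∁ x → [ b ] ∈ ∁ U) → a ∈ P x)
  WhyPT-[]⇔ {U} inv a = mk⇔ to from
    where
    open Equivalence (BangPT-[]⇔ (dualPT P) (∁-invariant inv) a)
      renaming (to to bang⇒witness; from to witness⇒bang)
    to : WhyPT P U [ a ] → ∀ x → (∀ b → b ∈ ∁ x → [ b ] ∈ ∁ U) → a ∈ P x
    to ∉Bang x h = em⇒dne em λ a∉Px →
      ∉Bang (witness⇒bang (∁ x , h , λ a∈P∁∁x → a∉Px (mono (∁∁⊆ x) a∈P∁∁x)))
    from : (∀ x → (∀ b → b ∈ ∁ x → [ b ] ∈ ∁ U) → a ∈ P x) → WhyPT P U [ a ]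
    from H bang with bang⇒witness bang
    ... | y , h , a∉P∁y = a∉P∁y (H (∁ y) λ b b∉∁y → h b (∁∁⊆ y b∉∁y))

  WhyPT-++⇔ : ExcludedMiddle (lsuc 0ℓ) → (U : Pred (List S) 0ℓ) (l l' : List S) →
    WhyPT P U (l ++ l') ⇔ (∀ (V V' : Pred (List S) 0ℓ) → Invariant V → Invariant V' →
      Star (∁ V) (∁ V') ⊆ ∁ U → WhyPT P V l ⊎ WhyPT P V' l')
  WhyPT-++⇔ em₁ U l l' = mk⇔ to from
    where
    open Equivalence (BangPT-++⇔ (dualPT P) (∁ U) l l')
      renaming (to to bang⇒split; from to split⇒bang)
    to : WhyPT P U (l ++ l') → ∀ V V' → Invariant V → Invariant V' →
      Star (∁ V) (∁ V') ⊆ ∁ U → WhyPT P V l ⊎ WhyPT P V' l'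
    to ∉Bang V V' invV invV' ∁V⋆∁V'⊆∁U = ¬×⇒¬⊎¬ em₁ λ (q , r) →
      ∉Bang (split⇒bang (∁ V , ∁ V' , ∁-invariant invV , ∁-invariant invV' , ∁V⋆∁V'⊆∁U , q , r))
    from : (∀ V V' → Invariant V → Invariant V' →
      Star (∁ V) (∁ V') ⊆ ∁ U → WhyPT P V l ⊎ WhyPT P V' l') → WhyPT P U (l ++ l')
    from H bang with bang⇒split bang
    ... | W , W' , invW , invW' , W⋆W'⊆∁U , q , r
        with H (∁ W) (∁ W') (∁-invariant invW) (∁-invariant invW')
               (λ w → W⋆W'⊆∁U (Star-mono (∁∁⊆ W) (∁∁⊆ W') w))
    ... | inj₁ ∉Bang = ∉Bang (BangPT-mono (dualPT P) (λ w∈W w∉W → w∉W w∈W) q)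
    ... | inj₂ ∉Bang = ∉Bang (BangPT-mono (dualPT P) (λ w∈W w∉W → w∉W w∈W) r)

lemma12 : ExcludedMiddle 0ℓ → ExcludedMiddle (lsuc 0ℓ) →
    (A : Interface) → (U : Pred (List (Interface.Carrier A)) 0ℓ) → Invariant U →
    ((a : Interface.Carrier A) →
      (BangPT (Interface.P A) U [ a ]
        ⇔ ∃ λ (x : Pred (Interface.Carrier A) 0ℓ) → (∀ b → b ∈ x → [ b ] ∈ U) × a ∈ Interface.P A x))
    × ((l l' : List (Interface.Carrier A)) →
      (BangPT (Interface.P A) U (l ++ l')
        ⇔ ∃₂ λ (V V' : Pred (List (Interface.Carrier A)) 0ℓ) →
            Invariant V × Invariant V' × (Star V V' ⊆ U)
            × BangPT (Interface.P A) V l × BangPT (Interface.P A) V' l'))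
    × ((a : Interface.Carrier A) →
      (WhyPT (Interface.P A) U [ a ]
        ⇔ (∀ (x : Pred (Interface.Carrier A) 0ℓ) → (∀ b → b ∈ ∁ x → [ b ] ∈ ∁ U) → a ∈ Interface.P A x)))
    × ((l l' : List (Interface.Carrier A)) →
      (WhyPT (Interface.P A) U (l ++ l')
        ⇔ (∀ (V V' : Pred (List (Interface.Carrier A)) 0ℓ) → Invariant V → Invariant V' →
            Star (∁ V) (∁ V') ⊆ ∁ U →
            WhyPT (Interface.P A) V l ⊎ WhyPT (Interface.P A) V' l')))
lemma12 em em₁ A U inv =
  BangPT-[]⇔ P inv , BangPT-++⇔ P U , WhyPT-[]⇔ em A inv , WhyPT-++⇔ em A em₁ U
  where open Interface A
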